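{- For any real number $k\ge2$ and any positive integer $z$ which is suitable for $k$, we have $D_2(k)\le z$.
   Context: Let $k\ge2$ be real and $K=\lfloor k\rfloor+1$. For $\mathbf{x}=(x_1,\dots,x_d)\in\mathbb{Z}_{>0}^d$, let $a_K(\mathbf{x})=d+|\{i:x_i<K\}|$, $b_K(\mathbf{x})=1+\sum_{i:x_i<K}1/x_i$, $\mathrm{aad}^*_K(\mathbf{x})=a_K(\mathbf{x})/b_K(\mathbf{x})$. $D_2(k)$ is the minimum integer $z$ such that there exist an integer $d\ge K$ and $\mathbf{x}\in\mathbb{Z}_{\ge2}^d$ with $\sum_i x_i=z$ and $\mathrm{aad}^*_K(\mathbf{x})>k$. A positive integer $z$ is suitable for $k$ if either $z\ge K^2$ or there exist integers $d$ and $s$ such that: (S1) $K\le d\le z/2$; (S2) $0\le s\le d-1$; (S3) $Ks+2(d-s)\le z\le Ks+(K-1)(d-s)$; (S4) writing $q=\lfloor (z-Ks)/(d-s)\rfloor$, $d_1=(z-Ks)\bmod (d-s)$ and $d_0=d-s-d_1$, we have $\frac{d+d_0+d_1}{1+d_0/q+d_1/(q+1)}>k$. -}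

module Defs where

open import Level using (0ℓ)
open import Data.Nat as ℕ using (ℕ; zero; suc; _<ᵇ_; _∸_)
import Data.Nat.DivMod as ND
open import Data.Integer using (+_)
open import Data.Rational using (ℚ; 0ℚ; 1ℚ; _<_; _+_; _*_; _÷_; _≟_; ≢-nonZero; _/_)
open import Data.Vec using (Vec; []; _∷_; sum)
open import Data.Bool using (if_then_else_)
open import Data.Product using (∃; Σ; _×_; _,_)
open import Data.Sum using (_⊎_)
open import Relation.Nullary using (¬_; yes; no)

-- Real numbers as Dedekind cuts over ℚ (agda-stdlib has no reals).
-- L q means q < k ; U q means k < q.

record ℝ : Set₁ where
  field
    L U         : ℚ → Set
    L-inhabited : ∃ λ q → L q
    U-inhabited : ∃ λ q → U q
    L-lower     : ∀ p q → p < q → L q → L p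
    L-open      : ∀ p → L p → ∃ λ q → p < q × L q
    U-upper     : ∀ p q → p < q → U p → U q
    U-open      : ∀ q → U q → ∃ λ p → p < q × U p
    disjoint    : ∀ q → ¬ (L q × U q)
    located     : ∀ p q → p < q → L p ⊎ U q

open ℝ public

_>ℝ_ : ℚ → ℝ → Set
q >ℝ k = U k q

_≥ℝ2 : ℝ → Set
k ≥ℝ2 = ¬ U k (+ 2 / 1)

-- K = ⌊k⌋ + 1, i.e. K is a natural with K - 1 ≤ k < K
IsFloorSuc : ℝ → ℕ → Set
IsFloorSuc k K = (1 ℕ.≤ K) × ¬ U k (+ (K ∸ 1) / 1) × U k (+ K / 1)

-- 1/n for n ≥ 1 (value at 0 is irrelevant: never used at 0)
recip : ℕ → ℚ
recip zero    = 0ℚ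
recip (suc n) = + 1 / suc n

fromℕ : ℕ → ℚ
fromℕ n = + n / 1

-- p / q (value when q = 0 is irrelevant: never used with q = 0)
divℚ : ℚ → ℚ → ℚ
divℚ p q with q ≟ 0ℚ
... | yes _ = 0ℚ
... | no q≢0 = _÷_ p q {{≢-nonZero q≢0}}

-- natural number floor division and remainder (value at divisor 0 irrelevant)
divℕ : ℕ → ℕ → ℕ
divℕ m zero    = 0
divℕ m (suc n) = m ND./ suc n

modℕ : ℕ → ℕ → ℕ
modℕ m zero    = m
modℕ m (suc n) = m ND.% suc n

smallCount : ∀ {d} → ℕ → Vec ℕ d → ℕ
smallCount K []       = 0
smallCount K (x ∷ xs) = if x <ᵇ K then suc (smallCount K xs) else smallCount K xs

smallRecipSum : ∀ {d} → ℕ → Vec ℕ d → ℚ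
smallRecipSum K []       = 0ℚ
smallRecipSum K (x ∷ xs) = if x <ᵇ K then recip x + smallRecipSum K xs else smallRecipSum K xs

aK : ∀ {d} → ℕ → Vec ℕ d → ℕ
aK {d} K xs = d ℕ.+ smallCount K xs

bK : ∀ {d} → ℕ → Vec ℕ d → ℚ
bK K xs = 1ℚ + smallRecipSum K xs

aad* : ∀ {d} → ℕ → Vec ℕ d → ℚ
aad* K xs = divℚ (fromℕ (aK K xs)) (bK K xs)

-- D₂(k) ≤ z : there is an admissible integer z' ≤ z, where z' is admissible
-- if there are d ≥ K and x ∈ ℤ_{≥2}^d with Σ x_i = z' and aad*_K(x) > k.
-- (D₂(k) is the minimum admissible integer.)

AllGe2 : ∀ {d} → Vec ℕ d → Set
AllGe2 []       = Data.Unit.⊤ where import Data.Unit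
AllGe2 (x ∷ xs) = (2 ℕ.≤ x) × AllGe2 xs

AdmissibleD₂ : ℝ → ℕ → ℕ → Set
AdmissibleD₂ k K z =
  Σ ℕ λ d → (K ℕ.≤ d) × Σ (Vec ℕ d) λ x →
    AllGe2 x × (sum x ≡ z) × (aad* K x >ℝ k)
  where open import Relation.Binary.PropositionalEquality using (_≡_)

D₂≤ : ℝ → ℕ → ℕ → Set
D₂≤ k K z = Σ ℕ λ z' → (z' ℕ.≤ z) × AdmissibleD₂ k K z'

S4value : ℕ → ℕ → ℕ → ℕ → ℚ
S4value K z d s =
  let m  = d ∸ s
      q  = divℕ (z ∸ K ℕ.* s) m
      d₁ = modℕ (z ∸ K ℕ.* s) m
      d₀ = m ∸ d₁
  in divℚ (fromℕ (d ℕ.+ d₀ ℕ.+ d₁))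
          (1ℚ + fromℕ d₀ * recip q + fromℕ d₁ * recip (suc q))

Suitable : ℝ → ℕ → ℕ → Set
Suitable k K z =
  (K ℕ.* K ℕ.≤ z) ⊎
  (Σ ℕ λ d → Σ ℕ λ s →
     (K ℕ.≤ d) × (2 ℕ.* d ℕ.≤ z) ×
     (s ℕ.< d) ×
     (K ℕ.* s ℕ.+ 2 ℕ.* (d ∸ s) ℕ.≤ z) ×
     (z ℕ.≤ K ℕ.* s ℕ.+ (K ∸ 1) ℕ.* (d ∸ s)) ×
     (S4value K z d s >ℝ k))

-- Put s copies of K into x and split the remaining mass z − Ks as evenly as possible
-- into d − s parts: d₁ parts of size q + 1 and d₀ parts of size q, where q = ⌊(z − Ks)/(d − s)⌋.
-- Condition S3 forces 2 ≤ q ≤ K − 1, and q + 1 < K as soon as d₁ > 0, so exactly the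
-- d − s balanced parts are small and aad*_K(x) is the S4 quantity. If z ≥ K², then K copies
-- of K already give aad*_K = K > k.
module Submission where

open import Defs
open import Data.Nat as ℕ using (ℕ; _≤_; zero; suc; _<ᵇ_; _∸_; _<_; z≤n; s≤s; NonZero)
open import Data.Nat.Properties
open import Data.Nat.DivMod using (_/_; _%_; m≡m%n+[m/n]*n; m*n/n≡m; /-monoˡ-≤; m%n<n)
open import Data.Nat.Solver using (module +-*-Solver)
open import Data.Integer using (+_)
import Data.Integer as ℤ
import Data.Integer.Properties as ℤ
open import Data.Rational as ℚ using (ℚ; 0ℚ; 1ℚ; mkℚ)
import Data.Rational.Properties as ℚ
import Data.Nat.Coprimality as Coprime
open import Data.Vec using (Vec; []; _∷_; sum; replicate; _++_)
open import Data.Vec.Properties using (sum-++)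
open import Data.Bool using (true; false)
open import Data.Bool.Properties using (T-≡)
open import Data.Product using (_,_; proj₂)
open import Data.Sum using (inj₁; inj₂)
open import Data.Unit using (tt)
open import Data.Empty using (⊥-elim)
open import Function.Bundles using (Equivalence)
open import Relation.Nullary.Decidable using (toWitness)
open import Relation.Binary.PropositionalEquality

<ᵇ-true : ∀ {x K} → x < K → (x <ᵇ K) ≡ true
<ᵇ-true x<K = Equivalence.to T-≡ (<⇒<ᵇ x<K)

<ᵇ-false : ∀ {x K} → K ≤ x → (x <ᵇ K) ≡ false
<ᵇ-false {K = zero}  _         = refl
<ᵇ-false {K = suc K} (s≤s K≤x) = <ᵇ-false K≤x

fromℕ-suc : ∀ n → fromℕ (suc n) ≡ 1ℚ ℚ.+ fromℕ n
fromℕ-suc n = begin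
  fromℕ (suc n)           ≡⟨ ℚ./-cong {p₁ = + suc n} (cong (ℤ._+_ (+ 1)) (sym (ℤ.*-identityʳ (+ n)))) refl ⟩
  1ℚ ℚ.+ mkℚ (+ n) 0 n⊥1  ≡⟨ cong (1ℚ ℚ.+_) (sym (ℚ.normalize-coprime n⊥1)) ⟩
  1ℚ ℚ.+ fromℕ n          ∎
  where
  open ≡-Reasoning
  n⊥1 : Coprime.Coprime n 1
  n⊥1 = Coprime.sym (Coprime.1-coprimeTo n)

module _ {K : ℕ} where

  smallCount-++ : ∀ {m n} (xs : Vec ℕ m) (ys : Vec ℕ n) →
                  smallCount K (xs ++ ys) ≡ smallCount K xs ℕ.+ smallCount K ys
  smallCount-++ []       ys = refl
  smallCount-++ (x ∷ xs) ys with x <ᵇ K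
  ... | true  = cong suc (smallCount-++ xs ys)
  ... | false = smallCount-++ xs ys

  smallRecipSum-++ : ∀ {m n} (xs : Vec ℕ m) (ys : Vec ℕ n) →
                     smallRecipSum K (xs ++ ys) ≡ smallRecipSum K xs ℚ.+ smallRecipSum K ys
  smallRecipSum-++ []       ys = sym (ℚ.+-identityˡ _)
  smallRecipSum-++ (x ∷ xs) ys with x <ᵇ K
  ... | true  = trans (cong (recip x ℚ.+_) (smallRecipSum-++ xs ys)) (sym (ℚ.+-assoc (recip x) _ _))
  ... | false = smallRecipSum-++ xs ys

  -- Stated with 0 < n → x < K so that an empty block may have any value.
  smallCount-replicate-< : ∀ n {x} → (0 < n → x < K) → smallCount K (replicate n x) ≡ n
  smallCount-replicate-< zero    _   = refl
  smallCount-replicate-< (suc n) x<K rewrite <ᵇ-true (x<K ℕ.z<s) =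
    cong suc (smallCount-replicate-< n λ _ → x<K ℕ.z<s)

  smallCount-replicate-≥ : ∀ n {x} → K ≤ x → smallCount K (replicate n x) ≡ 0
  smallCount-replicate-≥ zero    _   = refl
  smallCount-replicate-≥ (suc n) K≤x rewrite <ᵇ-false K≤x = smallCount-replicate-≥ n K≤x

  smallRecipSum-replicate-< : ∀ n {x} → (0 < n → x < K) →
                              smallRecipSum K (replicate n x) ≡ fromℕ n ℚ.* recip x
  smallRecipSum-replicate-< zero    {x} _   = sym (ℚ.*-zeroˡ (recip x))
  smallRecipSum-replicate-< (suc n) {x} x<K rewrite <ᵇ-true (x<K ℕ.z<s) = begin
    recip x ℚ.+ smallRecipSum K (replicate n x) ≡⟨ cong (recip x ℚ.+_) (smallRecipSum-replicate-< n λ _ → x<K ℕ.z<s) ⟩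
    recip x ℚ.+ fromℕ n ℚ.* recip x            ≡⟨ cong (ℚ._+ fromℕ n ℚ.* recip x) (sym (ℚ.*-identityˡ (recip x))) ⟩
    1ℚ ℚ.* recip x ℚ.+ fromℕ n ℚ.* recip x     ≡⟨ sym (ℚ.*-distribʳ-+ (recip x) 1ℚ (fromℕ n)) ⟩
    (1ℚ ℚ.+ fromℕ n) ℚ.* recip x               ≡⟨ cong (ℚ._* recip x) (sym (fromℕ-suc n)) ⟩
    fromℕ (suc n) ℚ.* recip x                  ∎
    where open ≡-Reasoning

  smallRecipSum-replicate-≥ : ∀ n {x} → K ≤ x → smallRecipSum K (replicate n x) ≡ 0ℚ
  smallRecipSum-replicate-≥ zero    _   = refl
  smallRecipSum-replicate-≥ (suc n) K≤x rewrite <ᵇ-false K≤x = smallRecipSum-replicate-≥ n K≤x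

  aad*-replicate-≥ : ∀ n {x} → K ≤ x → aad* K (replicate n x) ≡ fromℕ n
  aad*-replicate-≥ n K≤x
    rewrite smallCount-replicate-≥ n K≤x | smallRecipSum-replicate-≥ n K≤x | +-identityʳ n =
    ℚ.*-identityʳ (fromℕ n)

AllGe2-replicate : ∀ n {x} → 2 ≤ x → AllGe2 (replicate n x)
AllGe2-replicate zero    _   = tt
AllGe2-replicate (suc n) 2≤x = 2≤x , AllGe2-replicate n 2≤x

AllGe2-++ : ∀ {m n} (xs : Vec ℕ m) {ys : Vec ℕ n} → AllGe2 xs → AllGe2 ys → AllGe2 (xs ++ ys)
AllGe2-++ []       _          ys≥2 = ys≥2
AllGe2-++ (x ∷ xs) (x≥2 , xs≥2) ys≥2 = x≥2 , AllGe2-++ xs xs≥2 ys≥2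

sum-replicate : ∀ n x → sum (replicate n x) ≡ n ℕ.* x
sum-replicate zero    x = refl
sum-replicate (suc n) x = cong (x ℕ.+_) (sum-replicate n x)

threeBlocks : (s x q d₁ d₀ : ℕ) → Vec ℕ (s ℕ.+ (d₁ ℕ.+ d₀))
threeBlocks s x q d₁ d₀ = replicate s x ++ replicate d₁ (suc q) ++ replicate d₀ q

s4Ratio : (d q d₀ d₁ : ℕ) → ℚ
s4Ratio d q d₀ d₁ =
  divℚ (fromℕ (d ℕ.+ d₀ ℕ.+ d₁)) (1ℚ ℚ.+ fromℕ d₀ ℚ.* recip q ℚ.+ fromℕ d₁ ℚ.* recip (suc q))

sum-threeBlocks : ∀ s x q d₁ d₀ → sum (threeBlocks s x q d₁ d₀) ≡ s ℕ.* x ℕ.+ (d₁ ℕ.* suc q ℕ.+ d₀ ℕ.* q)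
sum-threeBlocks s x q d₁ d₀ = begin
  sum (replicate s x ++ replicate d₁ (suc q) ++ replicate d₀ q)
    ≡⟨ sum-++ (replicate s x) ⟩
  sum (replicate s x) ℕ.+ sum (replicate d₁ (suc q) ++ replicate d₀ q)
    ≡⟨ cong (sum (replicate s x) ℕ.+_) (sum-++ (replicate d₁ (suc q))) ⟩
  sum (replicate s x) ℕ.+ (sum (replicate d₁ (suc q)) ℕ.+ sum (replicate d₀ q))
    ≡⟨ cong₂ ℕ._+_ (sum-replicate s x) (cong₂ ℕ._+_ (sum-replicate d₁ (suc q)) (sum-replicate d₀ q)) ⟩
  s ℕ.* x ℕ.+ (d₁ ℕ.* suc q ℕ.+ d₀ ℕ.* q) ∎
  where open ≡-Reasoning

AllGe2-threeBlocks : ∀ s {x} {q} d₁ d₀ → 2 ≤ x → 2 ≤ q → AllGe2 (threeBlocks s x q d₁ d₀)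
AllGe2-threeBlocks s d₁ d₀ 2≤x 2≤q =
  AllGe2-++ (replicate s _) (AllGe2-replicate s 2≤x)
    (AllGe2-++ (replicate d₁ _) (AllGe2-replicate d₁ (m≤n⇒m≤1+n 2≤q)) (AllGe2-replicate d₀ 2≤q))

module _ {K : ℕ} (s : ℕ) {x q : ℕ} (d₁ d₀ : ℕ) (K≤x : K ≤ x) (q<K : q < K) (q+1<K : 0 < d₁ → suc q < K) where

  smallCount-threeBlocks : smallCount K (threeBlocks s x q d₁ d₀) ≡ d₁ ℕ.+ d₀
  smallCount-threeBlocks = begin
    smallCount K (replicate s x ++ replicate d₁ (suc q) ++ replicate d₀ q)
      ≡⟨ smallCount-++ (replicate s x) _ ⟩
    smallCount K (replicate s x) ℕ.+ smallCount K (replicate d₁ (suc q) ++ replicate d₀ q)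
      ≡⟨ cong₂ ℕ._+_ (smallCount-replicate-≥ s K≤x) (smallCount-++ (replicate d₁ (suc q)) _) ⟩
    smallCount K (replicate d₁ (suc q)) ℕ.+ smallCount K (replicate d₀ q)
      ≡⟨ cong₂ ℕ._+_ (smallCount-replicate-< d₁ q+1<K) (smallCount-replicate-< d₀ λ _ → q<K) ⟩
    d₁ ℕ.+ d₀ ∎
    where open ≡-Reasoning

  smallRecipSum-threeBlocks : smallRecipSum K (threeBlocks s x q d₁ d₀) ≡
                              fromℕ d₀ ℚ.* recip q ℚ.+ fromℕ d₁ ℚ.* recip (suc q)
  smallRecipSum-threeBlocks = begin
    smallRecipSum K (replicate s x ++ replicate d₁ (suc q) ++ replicate d₀ q)
      ≡⟨ smallRecipSum-++ (replicate s x) _ ⟩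
    smallRecipSum K (replicate s x) ℚ.+ smallRecipSum K (replicate d₁ (suc q) ++ replicate d₀ q)
      ≡⟨ cong₂ ℚ._+_ (smallRecipSum-replicate-≥ s K≤x) (smallRecipSum-++ (replicate d₁ (suc q)) _) ⟩
    0ℚ ℚ.+ (smallRecipSum K (replicate d₁ (suc q)) ℚ.+ smallRecipSum K (replicate d₀ q))
      ≡⟨ ℚ.+-identityˡ _ ⟩
    smallRecipSum K (replicate d₁ (suc q)) ℚ.+ smallRecipSum K (replicate d₀ q)
      ≡⟨ cong₂ ℚ._+_ (smallRecipSum-replicate-< d₁ q+1<K) (smallRecipSum-replicate-< d₀ λ _ → q<K) ⟩
    fromℕ d₁ ℚ.* recip (suc q) ℚ.+ fromℕ d₀ ℚ.* recip q
      ≡⟨ ℚ.+-comm (fromℕ d₁ ℚ.* recip (suc q)) _ ⟩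
    fromℕ d₀ ℚ.* recip q ℚ.+ fromℕ d₁ ℚ.* recip (suc q) ∎
    where open ≡-Reasoning

  aad*-threeBlocks : aad* K (threeBlocks s x q d₁ d₀) ≡ s4Ratio (s ℕ.+ (d₁ ℕ.+ d₀)) q d₀ d₁
  aad*-threeBlocks = cong₂ divℚ (cong fromℕ numerator) denominator
    where
    d = s ℕ.+ (d₁ ℕ.+ d₀)
    numerator : d ℕ.+ smallCount K (threeBlocks s x q d₁ d₀) ≡ d ℕ.+ d₀ ℕ.+ d₁
    numerator = trans (cong (d ℕ.+_) (trans smallCount-threeBlocks (+-comm d₁ d₀))) (sym (+-assoc d d₀ d₁))
    denominator : 1ℚ ℚ.+ smallRecipSum K (threeBlocks s x q d₁ d₀) ≡
                  1ℚ ℚ.+ fromℕ d₀ ℚ.* recip q ℚ.+ fromℕ d₁ ℚ.* recip (suc q)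
    denominator = trans (cong (1ℚ ℚ.+_) smallRecipSum-threeBlocks) (sym (ℚ.+-assoc 1ℚ (fromℕ d₀ ℚ.* recip q) _))

threeBlocks-admissible : ∀ {k K} s {q} d₁ d₀ → 2 ≤ K → 2 ≤ q → q < K → (0 < d₁ → suc q < K) →
                         K ≤ s ℕ.+ (d₁ ℕ.+ d₀) → s4Ratio (s ℕ.+ (d₁ ℕ.+ d₀)) q d₀ d₁ >ℝ k →
                         AdmissibleD₂ k K (s ℕ.* K ℕ.+ (d₁ ℕ.* suc q ℕ.+ d₀ ℕ.* q))
threeBlocks-admissible {k} {K} s {q} d₁ d₀ 2≤K 2≤q q<K q+1<K K≤d ratio>k =
  s ℕ.+ (d₁ ℕ.+ d₀) , K≤d , threeBlocks s K q d₁ d₀ ,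
  AllGe2-threeBlocks s d₁ d₀ 2≤K 2≤q , sum-threeBlocks s K q d₁ d₀ ,
  subst (U k) (sym (aad*-threeBlocks s d₁ d₀ ≤-refl q<K q+1<K)) ratio>k

module _ {c r : ℕ} (m : ℕ) .{{_ : NonZero m}} where

  ≤-quotient : c ℕ.* m ≤ r → c ≤ r / m
  ≤-quotient cm≤r = ≤-trans (≤-reflexive (sym (m*n/n≡m c m))) (/-monoˡ-≤ m cm≤r)

  quotient-≤ : r ≤ c ℕ.* m → r / m ≤ c
  quotient-≤ r≤cm = ≤-trans (/-monoˡ-≤ m r≤cm) (≤-reflexive (m*n/n≡m c m))

  quotient-< : r ≤ c ℕ.* m → 0 < r % m → r / m < c
  quotient-< r≤cm 0<r%m = *-cancelʳ-< m (r / m) c (begin-strict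
    r / m ℕ.* m             <⟨ m<n+m (r / m ℕ.* m) 0<r%m ⟩
    r % m ℕ.+ r / m ℕ.* m   ≡⟨ m≡m%n+[m/n]*n r m ⟨
    r                       ≤⟨ r≤cm ⟩
    c ℕ.* m                 ∎)
    where open ≤-Reasoning

balanced-sum : ∀ r m .{{_ : NonZero m}} → r % m ℕ.* suc (r / m) ℕ.+ (m ∸ r % m) ℕ.* (r / m) ≡ r
balanced-sum r m = begin
  d₁ ℕ.* suc q ℕ.+ d₀ ℕ.* q   ≡⟨ solve 3 (λ d₁ d₀ q → d₁ :* (con 1 :+ q) :+ d₀ :* q := d₁ :+ (d₁ :+ d₀) :* q) refl d₁ d₀ q ⟩
  d₁ ℕ.+ (d₁ ℕ.+ d₀) ℕ.* q    ≡⟨ cong (λ n → d₁ ℕ.+ n ℕ.* q) (m+[n∸m]≡n (<⇒≤ (m%n<n r m))) ⟩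
  d₁ ℕ.+ m ℕ.* q              ≡⟨ cong (d₁ ℕ.+_) (*-comm m q) ⟩
  d₁ ℕ.+ q ℕ.* m              ≡⟨ m≡m%n+[m/n]*n r m ⟨
  r                           ∎
  where
  open ≡-Reasoning
  open +-*-Solver
  q = r / m
  d₁ = r % m
  d₀ = m ∸ d₁

split-admissible : ∀ {k K d} s m r → 2 ≤ K → K ≤ d → s ℕ.+ m ≡ d → 0 < m →
                   2 ℕ.* m ≤ r → r ≤ (K ∸ 1) ℕ.* m →
                   s4Ratio d (divℕ r m) (m ∸ modℕ r m) (modℕ r m) >ℝ k →
                   AdmissibleD₂ k K (K ℕ.* s ℕ.+ r)
split-admissible {k} {suc c} {d} s m@(suc _) r 2≤K K≤d s+m≡d _ 2m≤r r≤cm ratio>k =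
  subst (AdmissibleD₂ k (suc c)) total
    (threeBlocks-admissible {k} s d₁ d₀ 2≤K (≤-quotient m 2m≤r) (s≤s (quotient-≤ m r≤cm))
      (λ 0<d₁ → s≤s (quotient-< m r≤cm 0<d₁))
      (subst (suc c ≤_) d≡s+d₁+d₀ K≤d) (subst (λ d → s4Ratio d q d₀ d₁ >ℝ k) d≡s+d₁+d₀ ratio>k))
  where
  q = r / m
  d₁ = r % m
  d₀ = m ∸ d₁
  d≡s+d₁+d₀ : d ≡ s ℕ.+ (d₁ ℕ.+ d₀)
  d≡s+d₁+d₀ = trans (sym s+m≡d) (cong (s ℕ.+_) (sym (m+[n∸m]≡n (<⇒≤ (m%n<n r m)))))
  total : s ℕ.* suc c ℕ.+ (d₁ ℕ.* suc q ℕ.+ d₀ ℕ.* q) ≡ suc c ℕ.* s ℕ.+ r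
  total = cong₂ ℕ._+_ (*-comm s (suc c)) (balanced-sum r m)

floorSuc≥2 : ∀ {k K} → k ≥ℝ2 → IsFloorSuc k K → 2 ≤ K
floorSuc≥2 {K = zero}          _   (() , _)
floorSuc≥2 {k} {K = suc zero}  k≥2 (_ , _ , k<1) =
  ⊥-elim (k≥2 (U-upper k _ _ (toWitness {a? = fromℕ 1 ℚ.<? fromℕ 2} tt) k<1))
floorSuc≥2 {K = suc (suc _)}   _   _ = s≤s (s≤s z≤n)

lemma10 : (k : ℝ) → k ≥ℝ2 → (K : ℕ) → IsFloorSuc k K →
          (z : ℕ) → 1 ≤ z → Suitable k K z → D₂≤ k K z
lemma10 k k≥2 K K-floor z _ (inj₁ K*K≤z) =
  K ℕ.* K , K*K≤z , K , ≤-refl , replicate K K ,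
  AllGe2-replicate K (floorSuc≥2 {k} k≥2 K-floor) , sum-replicate K K ,
  subst (U k) (sym (aad*-replicate-≥ K ≤-refl)) (proj₂ (proj₂ K-floor))
-- The bound 2d ≤ z of S1 is implied by S3 and not needed.
lemma10 k k≥2 K K-floor z _ (inj₂ (d , s , K≤d , _ , s<d , S3-lower , S3-upper , S4)) =
  z , ≤-refl , subst (AdmissibleD₂ k K) (m+[n∸m]≡n Ks≤z)
    (split-admissible {k} s (d ∸ s) (z ∸ K ℕ.* s) (floorSuc≥2 {k} k≥2 K-floor) K≤d
      (m+[n∸m]≡n (<⇒≤ s<d)) (m<n⇒0<n∸m s<d) 2m≤r (m≤n+o⇒m∸n≤o z (K ℕ.* s) S3-upper) S4)
  where
  Ks≤z : K ℕ.* s ≤ z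
  Ks≤z = m+n≤o⇒m≤o (K ℕ.* s) S3-lower
  2m≤r : 2 ℕ.* (d ∸ s) ≤ z ∸ K ℕ.* s
  2m≤r = m+n≤o⇒m≤o∸n (2 ℕ.* (d ∸ s)) (subst (_≤ z) (+-comm (K ℕ.* s) _) S3-lower)
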